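{- For $n\geq 1$, $|\hat{\mathcal{B}}_n(231)|=2^{n-1}-n+1$.
   Context: An endofunction of size $n$ is a word $x=x_1\cdots x_n$ with entries in $\{1,\dots,n\}$; it is a Cayley permutation if it contains every integer between $1$ and $\max(x)$. Let $\mathrm{Ascbot}(x)=\{1\}\cup\{i:1\leq i\leq n-1,\ x_i<x_{i+1}\}$ and $\mathrm{Nub}(x)$ the set of indices $i$ such that $x_i$ is the leftmost occurrence of its value. A revised ascent sequence of length $n$ is a Cayley permutation $x$ of length $n$ with $\mathrm{Ascbot}(x)=\mathrm{Nub}(x)$. For Cayley permutations $x$ and $\sigma=\sigma_1\cdots\sigma_k$, $x$ contains $\sigma$ if there are indices $i_1<\cdots<i_k$ such that for all $s,t$: $x_{i_s}<x_{i_t}\iff\sigma_s<\sigma_t$ and $x_{i_s}=x_{i_t}\iff\sigma_s=\sigma_t$; otherwise $x$ avoids $\sigma$. $\hat{\mathcal{B}}_n(\sigma)$ is the set of revised ascent sequences of length $n$ avoiding $\sigma$. -}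

module Defs where

open import Data.Nat using (ℕ; zero; suc; _<_; _≤_; _^_; _∸_; _+_; _≟_; _≤?_; _<?_)
open import Data.Fin using (Fin; toℕ)
open import Relation.Nullary.Decidable using (_×-dec_; _⊎-dec_; _→-dec_; ¬?)
open import Data.Fin using (Fin; toℕ)
open import Data.Fin.Properties using (all?; any?)
import Data.Fin.Properties as FinP
open import Data.Vec using (Vec; lookup)
open import Data.Vec.Relation.Unary.All using () renaming (All to VAll)
open import Data.List using (List; length; filter; []; _∷_; concatMap; map; allFin)
open import Data.Product using (Σ; ∃; _×_; _,_)
open import Data.Sum using (_⊎_)
open import Relation.Nullary using (¬_; Dec)
open import Relation.Binary.PropositionalEquality using (_≡_)
open import Data.Vec using ([]; _∷_)

-- An endofunction of size n: a word x₁⋯xₙ with entries in {1,…,n}.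
-- We represent it as a vector of length n with entries in Fin n, where the
-- value v : Fin n stands for the integer (toℕ v + 1).  Positions are also
-- 0-based: position i : Fin n stands for index (toℕ i + 1).
Endo : ℕ → Set
Endo n = Vec (Fin n) n

val : ∀ {n} → Endo n → Fin n → ℕ
val x i = toℕ (lookup x i)

-- Cayley permutation: every integer between 1 and max(x) occurs, i.e.
-- every value v that is ≤ some entry of x is itself an entry of x
-- (such a v is automatically < n, so v ranges over Fin n).
IsCayley : ∀ {n} → Endo n → Set
IsCayley {n} x = (v : Fin n) → (i : Fin n) → toℕ v ≤ val x i → ∃ λ j → lookup x j ≡ v

-- Ascbot(x) = {1} ∪ {i : 1 ≤ i ≤ n-1, x_i < x_{i+1}} (in 0-based positions:
-- position 0, or position i with i+1 < n and x at i < x at i+1).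
InAscbot : ∀ {n} → Endo n → Fin n → Set
InAscbot {n} x i =
  toℕ i ≡ 0 ⊎ (Σ (Fin n) λ j → (toℕ j ≡ suc (toℕ i)) × (val x i < val x j))

InNub : ∀ {n} → Endo n → Fin n → Set
InNub {n} x i = (j : Fin n) → toℕ j < toℕ i → ¬ (val x j ≡ val x i)

IsRevisedAscent : ∀ {n} → Endo n → Set
IsRevisedAscent {n} x =
  IsCayley x × ((i : Fin n) → (InAscbot x i → InNub x i) × (InNub x i → InAscbot x i))

-- x contains the pattern 231: indices i < j < k with x_k < x_i < x_j
-- (for σ = 231 the order-isomorphism condition is exactly this).
Contains231 : ∀ {n} → Endo n → Set
Contains231 {n} x =
  Σ (Fin n) λ i → Σ (Fin n) λ j → Σ (Fin n) λ k →
    (toℕ i < toℕ j) × (toℕ j < toℕ k) × (val x k < val x i) × (val x i < val x j)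

Avoids231 : ∀ {n} → Endo n → Set
Avoids231 x = ¬ Contains231 x

allVecs : ∀ {n} m → List (Vec (Fin n) m)
allVecs zero = [] ∷ []
allVecs {n} (suc m) =
  concatMap (λ v → map (λ xs → v ∷ xs) (allVecs m)) (allFin n)

isRevisedAscent? : ∀ {n} (x : Endo n) → Dec (IsRevisedAscent x)
isRevisedAscent? {n} x =
  (all? λ v → all? λ i → (toℕ v ≤? val x i) →-dec any? λ j → lookup x j FinP.≟ v)
  ×-dec
  all? (λ i → (asc? i →-dec nub? i) ×-dec (nub? i →-dec asc? i))
  where
  asc? : (i : Fin n) → Dec (InAscbot x i)
  asc? i = (toℕ i ≟ 0) ⊎-dec any? (λ j → (toℕ j ≟ suc (toℕ i)) ×-dec (val x i <? val x j))
  nub? : (i : Fin n) → Dec (InNub x i)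
  nub? i = all? λ j → (toℕ j <? toℕ i) →-dec ¬? (val x j ≟ val x i)

avoids231? : ∀ {n} (x : Endo n) → Dec (Avoids231 x)
avoids231? {n} x = ¬? (any? λ i → any? λ j → any? λ k →
  (toℕ i <? toℕ j) ×-dec (toℕ j <? toℕ k) ×-dec (val x k <? val x i) ×-dec (val x i <? val x j))

-- B̂_n(231) as an explicit list: the endofunctions of size n that are
-- revised ascent sequences avoiding 231 (each occurs exactly once).
B̂231 : (n : ℕ) → List (Endo n)
B̂231 n = filter (λ x → isRevisedAscent? x ×-dec avoids231? x) (allVecs n)

-- Shifting values down by one, a 231-avoiding revised ascent sequence of length n ≥ 1 is either
-- 0ⁿ or, with k ≥ 1 its first letter, a word  k⁺ 0 k* 1 k* ⋯ (k−1) k⁺ (k−1)*.  Every leftmost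
-- occurrence after position 0 is an ascent bottom, so the first letter is the maximum, the values
-- below k first appear in increasing order, and the first k−1 is followed by k; after that,
-- avoiding 231 leaves only k's and (k−1)'s, and a repeated k−1 cannot rise to k.  These words form
-- the language of a deterministic automaton; one prefix invariant (Shape) is preserved by its
-- transitions and is forced by validity, which gives both inclusions.  Counting accepted words
-- state by state yields C(n−1, k+1) words with first letter k, and
-- 1 + Σₖ C(n−1, k+1) = 2ⁿ⁻¹ − n + 1.
module Submission where

open import Defs

open import Data.Bool using (Bool; true; false; T)
open import Data.Bool.Properties using (T?)
open import Data.Empty using (⊥; ⊥-elim)
open import Data.Fin as Fin using (Fin; toℕ; fromℕ<)
open import Data.Fin.Properties using (toℕ<n; toℕ-fromℕ<; toℕ-injective)
open import Data.List using (List; []; _∷_; _++_; map; length; filter; concatMap; applyUpTo; tabulate; allFin)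
open import Data.List.Properties using (filter-++; length-++; filter-≐; filter-none; map-cong; map-tabulate)
open import Data.List.Relation.Unary.All using (universal)
open import Data.Maybe using (Maybe; just; nothing; maybe)
open import Data.Nat
open import Data.Nat.Combinatorics using (_C_; nC1≡n; nCk+nC[k+1]≡[n+1]C[k+1]; k>n⇒nCk≡0)
open import Data.Nat.Induction using (<-rec)
open import Data.Nat.ListAction using (sum)
open import Data.Nat.Properties
open import Algebra.Properties.CommutativeSemigroup +-commutativeSemigroup using (interchange)
open import Data.Product using (∃-syntax; _×_; _,_; proj₁; proj₂)
open import Data.Sum using (_⊎_; inj₁; inj₂; [_,_]′)
open import Data.Vec using (Vec; []; _∷_; lookup)
open import Function using (_∘_)
open import Relation.Binary.Definitions using (tri<; tri≈; tri>)
open import Relation.Binary.PropositionalEquality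
open import Relation.Nullary using (¬_; yes; no; does)
open import Relation.Nullary.Decidable using (dec-no; _×-dec_)
open import Relation.Unary using (Pred; Decidable)

<-suc-extend : ∀ {P : ℕ → Set} {i} → (∀ {l} → l < i → P l) → P i → ∀ {l} → l < suc i → P l
<-suc-extend below at l<1+i with m<1+n⇒m<n∨m≡n l<1+i
... | inj₁ l<i = below l<i
... | inj₂ refl = at

sum-applyUpTo-cong : ∀ {f g : ℕ → ℕ} t → (∀ c → c < t → f c ≡ g c) →
                     sum (applyUpTo f t) ≡ sum (applyUpTo g t)
sum-applyUpTo-cong zero    f≡g = refl
sum-applyUpTo-cong (suc t) f≡g =
  cong₂ _+_ (f≡g 0 z<s) (sum-applyUpTo-cong t (λ c c<t → f≡g (suc c) (s<s c<t)))

sum-applyUpTo-+ : ∀ (f g : ℕ → ℕ) t →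
                  sum (applyUpTo (λ c → f c + g c) t) ≡ sum (applyUpTo f t) + sum (applyUpTo g t)
sum-applyUpTo-+ f g zero    = refl
sum-applyUpTo-+ f g (suc t) = begin
  f 0 + g 0 + sum (applyUpTo (λ c → f (suc c) + g (suc c)) t)
    ≡⟨ cong (f 0 + g 0 +_) (sum-applyUpTo-+ (f ∘ suc) (g ∘ suc) t) ⟩
  f 0 + g 0 + (sum (applyUpTo (f ∘ suc) t) + sum (applyUpTo (g ∘ suc) t))
    ≡⟨ interchange (f 0) (g 0) _ _ ⟩
  f 0 + sum (applyUpTo (f ∘ suc) t) + (g 0 + sum (applyUpTo (g ∘ suc) t)) ∎
  where open ≡-Reasoning

sum-applyUpTo-zeros : ∀ {f : ℕ → ℕ} t → (∀ c → f c ≡ 0) → sum (applyUpTo f t) ≡ 0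
sum-applyUpTo-zeros zero    f≡0 = refl
sum-applyUpTo-zeros (suc t) f≡0 = cong₂ _+_ (f≡0 0) (sum-applyUpTo-zeros t (f≡0 ∘ suc))

sum-applyUpTo-point : ∀ {f : ℕ → ℕ} t a → a < t → (∀ c → c ≢ a → f c ≡ 0) →
                      sum (applyUpTo f t) ≡ f a
sum-applyUpTo-point {f} (suc t) zero    _   off = begin
  f 0 + sum (applyUpTo (f ∘ suc) t) ≡⟨ cong (f 0 +_) (sum-applyUpTo-zeros t (λ c → off (suc c) λ ())) ⟩
  f 0 + 0                           ≡⟨ +-identityʳ (f 0) ⟩
  f 0                               ∎
  where open ≡-Reasoning
sum-applyUpTo-point         (suc t) (suc a) a<t off =
  cong₂ _+_ (off 0 λ ()) (sum-applyUpTo-point t a (s<s⁻¹ a<t) (λ c c≢a → off (suc c) (c≢a ∘ suc-injective)))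

sum-applyUpTo-points : ∀ {f : ℕ → ℕ} t a b → a < t → b < t → a ≢ b →
                       (∀ c → c ≢ a → c ≢ b → f c ≡ 0) → sum (applyUpTo f t) ≡ f a + f b
sum-applyUpTo-points     (suc t) zero    zero    _   _   a≢b off = ⊥-elim (a≢b refl)
sum-applyUpTo-points     (suc t) zero    (suc b) _   b<t _   off =
  cong (_ +_) (sum-applyUpTo-point t b (s<s⁻¹ b<t) (λ c c≢b → off (suc c) (λ ()) (c≢b ∘ suc-injective)))
sum-applyUpTo-points {f} (suc t) (suc a) zero    a<t _   _   off = trans
  (cong (f 0 +_) (sum-applyUpTo-point t a (s<s⁻¹ a<t) (λ c c≢a → off (suc c) (c≢a ∘ suc-injective) (λ ()))))
  (+-comm (f 0) (f (suc a)))
sum-applyUpTo-points     (suc t) (suc a) (suc b) a<t b<t a≢b off =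
  cong₂ _+_ (off 0 (λ ()) (λ ()))
    (sum-applyUpTo-points t a b (s<s⁻¹ a<t) (s<s⁻¹ b<t) (a≢b ∘ cong suc)
      (λ c c≢a c≢b → off (suc c) (c≢a ∘ suc-injective) (c≢b ∘ suc-injective)))

binomial-row-sum : ∀ m t → m < t → sum (applyUpTo (m C_) t) ≡ 2 ^ m
binomial-row-sum zero    (suc t) _   = cong suc (sum-applyUpTo-zeros t (λ c → k>n⇒nCk≡0 {k = suc c} z<s))
binomial-row-sum (suc m) (suc t) m<t = begin
  1 + sum (applyUpTo (λ c → suc m C suc c) t)
    ≡⟨ cong suc (sum-applyUpTo-cong t (λ c _ → sym (nCk+nC[k+1]≡[n+1]C[k+1] m c))) ⟩
  1 + sum (applyUpTo (λ c → m C c + m C suc c) t)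
    ≡⟨ cong suc (sum-applyUpTo-+ (m C_) ((m C_) ∘ suc) t) ⟩
  1 + (sum (applyUpTo (m C_) t) + sum (applyUpTo ((m C_) ∘ suc) t))
    ≡⟨ cong suc (+-comm (sum (applyUpTo (m C_) t)) _) ⟩
  1 + (sum (applyUpTo ((m C_) ∘ suc) t) + sum (applyUpTo (m C_) t))
    ≡⟨ +-comm (sum (applyUpTo (m C_) (suc t))) _ ⟩
  sum (applyUpTo (m C_) t) + sum (applyUpTo (m C_) (suc t))
    ≡⟨ cong₂ _+_ (binomial-row-sum m t (s<s⁻¹ m<t)) (binomial-row-sum m (suc t) (m<n⇒m<1+n (s<s⁻¹ m<t))) ⟩
  2 ^ m + 2 ^ m
    ≡⟨ cong (2 ^ m +_) (sym (+-identityʳ (2 ^ m))) ⟩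
  2 ^ suc m ∎
  where open ≡-Reasoning

tabulate-toℕ : ∀ n (g : ℕ → ℕ) → tabulate {n = n} (g ∘ toℕ) ≡ applyUpTo g n
tabulate-toℕ zero    g = refl
tabulate-toℕ (suc n) g = cong (g 0 ∷_) (tabulate-toℕ n (g ∘ suc))

module _ {A B : Set} {p} {P : Pred B p} (P? : Decidable P) where

  length-filter-map : ∀ (f : A → B) xs → length (filter P? (map f xs)) ≡ length (filter (P? ∘ f) xs)
  length-filter-map f []       = refl
  length-filter-map f (x ∷ xs) with does (P? (f x))
  ... | true  = cong suc (length-filter-map f xs)
  ... | false = length-filter-map f xs

  length-filter-concatMap : ∀ (f : A → List B) xs →
    length (filter P? (concatMap f xs)) ≡ sum (map (length ∘ filter P? ∘ f) xs)
  length-filter-concatMap f []       = refl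
  length-filter-concatMap f (x ∷ xs) = begin
    length (filter P? (f x ++ concatMap f xs))
      ≡⟨ cong length (filter-++ P? (f x) _) ⟩
    length (filter P? (f x) ++ filter P? (concatMap f xs))
      ≡⟨ length-++ (filter P? (f x)) ⟩
    length (filter P? (f x)) + length (filter P? (concatMap f xs))
      ≡⟨ cong (_ +_) (length-filter-concatMap f xs) ⟩
    length (filter P? (f x)) + sum (map (length ∘ filter P? ∘ f) xs) ∎
    where open ≡-Reasoning

j≢j+1+d : ∀ j d → j ≢ j + suc d
j≢j+1+d j d = <⇒≢ (m<m+n j z<s)

-- A word is read left to right; k is its first letter and a = k − 1.  `zeros` has read 0⁺,
-- `interleave j d` has read k⁺ 0 k* 1 k* ⋯ (j−1) k* where k = j + suc d, `lastNew a` has just read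
-- the first a, `plateau a` reads the block of k's after it and `trail a` the final block of a's.
data State : Set where
  start zeros : State
  interleave  : ℕ → ℕ → State
  lastNew plateau trail : ℕ → State

infix 4 _⟶[_]_

data _⟶[_]_ : State → ℕ → State → Set where
  start→zeros      : start ⟶[ 0 ] zeros
  start→interleave : ∀ {d} → start ⟶[ suc d ] interleave 0 d
  zeros→zeros      : zeros ⟶[ 0 ] zeros
  interleave-top   : ∀ {j d} → interleave j d ⟶[ j + suc d ] interleave j d
  interleave-new   : ∀ {j d} → interleave j (suc d) ⟶[ j ] interleave (suc j) d
  interleave-last  : ∀ {j} → interleave j 0 ⟶[ j ] lastNew j
  lastNew→plateau  : ∀ {a} → lastNew a ⟶[ suc a ] plateau a
  plateau-top      : ∀ {a} → plateau a ⟶[ suc a ] plateau a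
  plateau→trail    : ∀ {a} → plateau a ⟶[ a ] trail a
  trail-stay       : ∀ {a} → trail a ⟶[ a ] trail a

final : State → Bool
final zeros       = true
final (plateau _) = true
final (trail _)   = true
final _           = false

afterNew : ℕ → ℕ → State
afterNew j zero    = lastNew j
afterNew j (suc d) = interleave (suc j) d

interleave⟶afterNew : ∀ j d → interleave j d ⟶[ j ] afterNew j d
interleave⟶afterNew j zero    = interleave-last
interleave⟶afterNew j (suc d) = interleave-new

start-step : ∀ c → ∃[ s' ] start ⟶[ c ] s'
start-step zero    = zeros , start→zeros
start-step (suc d) = interleave 0 d , start→interleave

step : State → ℕ → Maybe State
step start            zero    = just zeros
step start            (suc d) = just (interleave 0 d)
step zeros            zero    = just zeros
step zeros            (suc _) = nothing
step (interleave j d) c with c ≟ j + suc d | c ≟ j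
... | yes _ | _     = just (interleave j d)
... | no _  | yes _ = just (afterNew j d)
... | no _  | no _  = nothing
step (lastNew a)      c with c ≟ suc a
... | yes _ = just (plateau a)
... | no _  = nothing
step (plateau a)      c with c ≟ suc a | c ≟ a
... | yes _ | _     = just (plateau a)
... | no _  | yes _ = just (trail a)
... | no _  | no _  = nothing
step (trail a)        c with c ≟ a
... | yes _ = just (trail a)
... | no _  = nothing

step-sound : ∀ {s c s'} → step s c ≡ just s' → s ⟶[ c ] s'
step-sound {start}          {zero}  refl = start→zeros
step-sound {start}          {suc d} refl = start→interleave
step-sound {zeros}          {zero}  refl = zeros→zeros
step-sound {interleave j d} {c} eq with c ≟ j + suc d | c ≟ j
step-sound {interleave j d} refl | yes refl | _        = interleave-top
step-sound {interleave j d} refl | no _     | yes refl = interleave⟶afterNew j d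
step-sound {lastNew a}      {c} eq with c ≟ suc a
step-sound {lastNew a}      refl | yes refl = lastNew→plateau
step-sound {plateau a}      {c} eq with c ≟ suc a | c ≟ a
step-sound {plateau a}      refl | yes refl | _        = plateau-top
step-sound {plateau a}      refl | no _     | yes refl = plateau→trail
step-sound {trail a}        {c} eq with c ≟ a
step-sound {trail a}        refl | yes refl = trail-stay

step-complete : ∀ {s c s'} → s ⟶[ c ] s' → step s c ≡ just s'
step-complete start→zeros      = refl
step-complete start→interleave = refl
step-complete zeros→zeros      = refl
step-complete (interleave-top {j} {d})
  rewrite ≟-diag (refl {x = j + suc d}) = refl
step-complete (interleave-new {j} {d})
  rewrite dec-no (j ≟ j + suc (suc d)) (j≢j+1+d j (suc d)) | ≟-diag (refl {x = j}) = refl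
step-complete (interleave-last {j})
  rewrite dec-no (j ≟ j + 1) (j≢j+1+d j 0) | ≟-diag (refl {x = j}) = refl
step-complete (lastNew→plateau {a})
  rewrite ≟-diag (refl {x = suc a}) = refl
step-complete (plateau-top {a})
  rewrite ≟-diag (refl {x = suc a}) = refl
step-complete (plateau→trail {a})
  rewrite dec-no (a ≟ suc a) (1+n≢n ∘ sym) | ≟-diag (refl {x = a}) = refl
step-complete (trail-stay {a})
  rewrite ≟-diag (refl {x = a}) = refl

module Counting (N : ℕ) where

  accepts : ∀ {L} → State → Vec (Fin N) L → Bool
  accepts s []      = final s
  accepts s (v ∷ w) = maybe (λ s' → accepts s' w) false (step s (toℕ v))

  #accepted : State → ℕ → ℕ
  #accepted s L = length (filter (T? ∘ accepts s) (allVecs L))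

  #acceptedFrom : Maybe State → ℕ → ℕ
  #acceptedFrom ms L = maybe (λ s → #accepted s L) 0 ms

  #accepted-suc : ∀ s L → #accepted s (suc L) ≡ sum (applyUpTo (λ c → #acceptedFrom (step s c) L) N)
  #accepted-suc s L = begin
    length (filter P? (concatMap (λ v → map (v ∷_) (allVecs L)) (allFin N)))
      ≡⟨ length-filter-concatMap P? (λ v → map (v ∷_) (allVecs L)) (allFin N) ⟩
    sum (map (λ v → length (filter P? (map (v ∷_) (allVecs L)))) (allFin N))
      ≡⟨ cong sum (map-cong (λ v → trans (length-filter-map P? (v ∷_) (allVecs L)) (after (step s (toℕ v))))
                            (allFin N)) ⟩
    sum (map (g ∘ toℕ) (allFin N))
      ≡⟨ cong sum (map-tabulate {n = N} (λ v → v) (g ∘ toℕ)) ⟩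
    sum (tabulate {n = N} (g ∘ toℕ))
      ≡⟨ cong sum (tabulate-toℕ N g) ⟩
    sum (applyUpTo g N) ∎
    where
    open ≡-Reasoning
    P? = T? ∘ accepts s
    g = λ c → #acceptedFrom (step s c) L
    after : ∀ ms → length (filter (T? ∘ λ w → maybe (λ s' → accepts s' w) false ms) (allVecs L)) ≡
                   #acceptedFrom ms L
    after nothing  = cong length (filter-none (T? ∘ λ _ → false) (universal (λ _ ()) (allVecs L)))
    after (just s) = refl

  #acceptedFrom-step : ∀ {s c t} L → s ⟶[ c ] t → #acceptedFrom (step s c) L ≡ #accepted t L
  #acceptedFrom-step L s⟶t rewrite step-complete s⟶t = refl

  #acceptedFrom-stuck : ∀ {s c} L → (∀ {t} → ¬ s ⟶[ c ] t) → #acceptedFrom (step s c) L ≡ 0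
  #acceptedFrom-stuck {s} {c} L stuck with step s c in eq
  ... | nothing = refl
  ... | just t  = ⊥-elim (stuck (step-sound eq))

  #accepted-one : ∀ {s a t} L → a < N → s ⟶[ a ] t → (∀ {c t'} → s ⟶[ c ] t' → c ≡ a) →
                  #accepted s (suc L) ≡ #accepted t L
  #accepted-one {s} {a} L a<N s⟶t only = begin
    #accepted s (suc L)                              ≡⟨ #accepted-suc s L ⟩
    sum (applyUpTo (λ c → #acceptedFrom (step s c) L) N)
      ≡⟨ sum-applyUpTo-point N a a<N (λ c c≢a → #acceptedFrom-stuck L (c≢a ∘ only)) ⟩
    #acceptedFrom (step s a) L                       ≡⟨ #acceptedFrom-step L s⟶t ⟩
    #accepted _ L                                    ∎
    where open ≡-Reasoning

  #accepted-two : ∀ {s a b t u} L → a < N → b < N → a ≢ b → s ⟶[ a ] t → s ⟶[ b ] u →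
                  (∀ {c t'} → s ⟶[ c ] t' → c ≡ a ⊎ c ≡ b) →
                  #accepted s (suc L) ≡ #accepted t L + #accepted u L
  #accepted-two {s} {a} {b} L a<N b<N a≢b s⟶t s⟶u only = begin
    #accepted s (suc L)                              ≡⟨ #accepted-suc s L ⟩
    sum (applyUpTo (λ c → #acceptedFrom (step s c) L) N)
      ≡⟨ sum-applyUpTo-points N a b a<N b<N a≢b
           (λ c c≢a c≢b → #acceptedFrom-stuck L (λ s⟶ → [ c≢a , c≢b ]′ (only s⟶))) ⟩
    #acceptedFrom (step s a) L + #acceptedFrom (step s b) L
      ≡⟨ cong₂ _+_ (#acceptedFrom-step L s⟶t) (#acceptedFrom-step L s⟶u) ⟩
    #accepted _ L + #accepted _ L                    ∎
    where open ≡-Reasoning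

  #accepted-zeros : 0 < N → ∀ L → #accepted zeros L ≡ 1
  #accepted-zeros 0<N zero    = refl
  #accepted-zeros 0<N (suc L) =
    trans (#accepted-one L 0<N zeros→zeros λ { zeros→zeros → refl }) (#accepted-zeros 0<N L)

  #accepted-trail : ∀ {a} → a < N → ∀ L → #accepted (trail a) L ≡ 1
  #accepted-trail a<N zero    = refl
  #accepted-trail a<N (suc L) = trans (#accepted-one L a<N trail-stay λ { trail-stay → refl }) (#accepted-trail a<N L)

  #accepted-plateau : ∀ {a} → suc a < N → ∀ L → #accepted (plateau a) L ≡ suc L
  #accepted-plateau a<N zero    = refl
  #accepted-plateau {a} 1+a<N (suc L) = begin
    #accepted (plateau a) (suc L)
      ≡⟨ #accepted-two L 1+a<N (<-trans (n<1+n a) 1+a<N) 1+n≢n plateau-top plateau→trail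
           (λ { plateau-top → inj₁ refl ; plateau→trail → inj₂ refl }) ⟩
    #accepted (plateau a) L + #accepted (trail a) L
      ≡⟨ cong₂ _+_ (#accepted-plateau 1+a<N L) (#accepted-trail (<-trans (n<1+n a) 1+a<N) L) ⟩
    suc L + 1 ≡⟨ +-comm (suc L) 1 ⟩
    suc (suc L) ∎
    where open ≡-Reasoning

  #accepted-lastNew : ∀ {a} → suc a < N → ∀ L → #accepted (lastNew a) L ≡ L
  #accepted-lastNew 1+a<N zero    = refl
  #accepted-lastNew 1+a<N (suc L) =
    trans (#accepted-one L 1+a<N lastNew→plateau λ { lastNew→plateau → refl }) (#accepted-plateau 1+a<N L)

  #accepted-interleave : ∀ j d L → j + suc d < N → #accepted (interleave j d) L ≡ L C suc (suc d)
  #accepted-interleave j d zero    _     = refl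
  #accepted-interleave j d (suc L) top<N = begin
    #accepted (interleave j d) (suc L)
      ≡⟨ #accepted-two L top<N (<-trans (m<m+n j z<s) top<N) (j≢j+1+d j d ∘ sym)
           interleave-top (interleave⟶afterNew j d) only ⟩
    #accepted (interleave j d) L + #accepted (afterNew j d) L
      ≡⟨ cong₂ _+_ (#accepted-interleave j d L top<N) (#accepted-afterNew d top<N) ⟩
    L C suc (suc d) + L C suc d
      ≡⟨ +-comm (L C suc (suc d)) _ ⟩
    L C suc d + L C suc (suc d)
      ≡⟨ nCk+nC[k+1]≡[n+1]C[k+1] L (suc d) ⟩
    suc L C suc (suc d) ∎
    where
    open ≡-Reasoning
    only : ∀ {d c t} → interleave j d ⟶[ c ] t → c ≡ j + suc d ⊎ c ≡ j
    only interleave-top  = inj₁ refl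
    only interleave-new  = inj₂ refl
    only interleave-last = inj₂ refl
    #accepted-afterNew : ∀ d → j + suc d < N → #accepted (afterNew j d) L ≡ L C suc d
    #accepted-afterNew zero    top<N = trans (#accepted-lastNew (subst (_< N) (+-comm j 1) top<N) L) (sym (nC1≡n L))
    #accepted-afterNew (suc d) top<N = #accepted-interleave (suc j) d L (subst (_< N) (+-suc j (suc d)) top<N)

#accepted-start : ∀ m → Counting.#accepted (suc m) start (suc m) ≡ 1 + sum (applyUpTo (λ d → m C suc (suc d)) m)
#accepted-start m = begin
  #accepted start (suc m)
    ≡⟨ #accepted-suc start m ⟩
  #accepted zeros m + sum (applyUpTo (λ d → #accepted (interleave 0 d) m) m)
    ≡⟨ cong₂ _+_ (#accepted-zeros z<s m) (sum-applyUpTo-cong m (λ d d<m → #accepted-interleave 0 d m (s<s d<m))) ⟩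
  1 + sum (applyUpTo (λ d → m C suc (suc d)) m) ∎
  where
  open ≡-Reasoning
  open Counting (suc m)

binomial-tail-sum : ∀ m → 1 + sum (applyUpTo (λ d → m C suc (suc d)) m) ≡ (2 ^ m ∸ suc m) + 1
binomial-tail-sum m = begin
  1 + S                     ≡⟨ +-comm 1 S ⟩
  S + 1                     ≡⟨ cong (_+ 1) (m+n∸m≡n (suc m) S) ⟨
  (suc m + S ∸ suc m) + 1   ≡⟨ cong (λ z → z ∸ suc m + 1) row ⟩
  (2 ^ m ∸ suc m) + 1       ∎
  where
  open ≡-Reasoning
  S = sum (applyUpTo (λ d → m C suc (suc d)) m)
  row : suc m + S ≡ 2 ^ m
  row = trans (cong (λ z → suc (z + S)) (sym (nC1≡n m)))
              (binomial-row-sum m (suc (suc m)) (m<n⇒m<1+n (n<1+n m)))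

-- Positions past the end of the word read as 0.
entry : ∀ {N L} → Vec (Fin N) L → ℕ → ℕ
entry []      _       = 0
entry (v ∷ w) zero    = toℕ v
entry (v ∷ w) (suc l) = entry w l

lookup-entry : ∀ {N L} (w : Vec (Fin N) L) i → toℕ (lookup w i) ≡ entry w (toℕ i)
lookup-entry (v ∷ w) Fin.zero    = refl
lookup-entry (v ∷ w) (Fin.suc i) = lookup-entry w i

module Word (n : ℕ) (X : ℕ → ℕ) where

  Ascent : ℕ → Set
  Ascent i = i ≡ 0 ⊎ (suc i < n × X i < X (suc i))

  Nub : ℕ → Set
  Nub i = ∀ {j} → j < i → X j ≢ X i

  record RevisedAscentAvoiding231 : Set where
    field
      cayley     : ∀ {v i} → i < n → v ≤ X i → ∃[ j ] j < n × X j ≡ v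
      ascent⇒nub : ∀ {i} → i < n → Ascent i → Nub i
      nub⇒ascent : ∀ {i} → i < n → Nub i → Ascent i
      avoids231  : ∀ {i j l} → i < j → j < l → l < n → X l < X i → X i < X j → ⊥

  occurs-before? : ∀ v i → (∃[ j ] j < i × X j ≡ v) ⊎ (∀ {j} → j < i → X j ≢ v)
  occurs-before? v zero = inj₂ λ ()
  occurs-before? v (suc i) with occurs-before? v i | X i ≟ v
  ... | inj₁ (j , j<i , Xj≡v) | _        = inj₁ (j , m<n⇒m<1+n j<i , Xj≡v)
  ... | inj₂ _                | yes Xi≡v = inj₁ (i , n<1+n i , Xi≡v)
  ... | inj₂ absent           | no Xi≢v  = inj₂ (<-suc-extend absent Xi≢v)

  first-occurrence : ∀ i → ∃[ p ] p ≤ i × X p ≡ X i × Nub p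
  first-occurrence = <-rec _ λ i rec → leftmost i (occurs-before? (X i) i) rec
    where
    leftmost : ∀ i → (∃[ j ] j < i × X j ≡ X i) ⊎ (∀ {j} → j < i → X j ≢ X i) →
               (∀ {j} → j < i → ∃[ p ] p ≤ j × X p ≡ X j × Nub p) → ∃[ p ] p ≤ i × X p ≡ X i × Nub p
    leftmost i (inj₂ nub)             _   = i , ≤-refl , refl , nub
    leftmost i (inj₁ (j , j<i , Xj≡)) rec with rec j<i
    ... | p , p≤j , Xp≡ , nub = p , ≤-trans p≤j (<⇒≤ j<i) , trans Xp≡ Xj≡ , nub

  maximum-position : ∀ {m} → 0 < m → ∃[ t ] t < m × (∀ {l} → l < m → X l ≤ X t)
  maximum-position {suc zero}    _ = 0 , z<s , λ { z<s → ≤-refl }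
  maximum-position {suc (suc m)} _ with maximum-position {suc m} z<s
  ... | t , t<1+m , max with X t ≤? X (suc m)
  ...   | yes Xt≤ = suc m , n<1+n (suc m) , <-suc-extend (λ l<1+m → ≤-trans (max l<1+m) Xt≤) ≤-refl
  ...   | no  Xt≰ = t , m<n⇒m<1+n t<1+m , <-suc-extend max (<⇒≤ (≰⇒> Xt≰))

  ascent-between : ∀ {i t} → i < t → X i < X t → ∃[ l ] i ≤ l × l < t × X l ≤ X i × X l < X (suc l)
  ascent-between {i} {suc t} i<1+t Xi<X1+t with X i <? X t | m<1+n⇒m<n∨m≡n i<1+t
  ... | no Xi≮Xt | _       = t , s≤s⁻¹ i<1+t , n<1+n t , ≮⇒≥ Xi≮Xt , ≤-<-trans (≮⇒≥ Xi≮Xt) Xi<X1+t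
  ... | yes Xi<Xt | inj₂ refl = ⊥-elim (<-irrefl refl Xi<Xt)
  ... | yes Xi<Xt | inj₁ i<t with ascent-between i<t Xi<Xt
  ...   | l , i≤l , l<t , Xl≤ , asc = l , i≤l , m<n⇒m<1+n l<t , Xl≤ , asc

  record Interleaved (k i j : ℕ) : Set where
    field
      first      : X 0 ≡ k
      nonempty   : 0 < i
      increasing : ∀ {l'} → l' < i → ∀ {l} → l < l' → X l ≢ k → X l' ≢ k → X l < X l'
      below      : ∀ {l} → l < i → X l ≢ k → X l < j
      covers     : ∀ {v} → v < j → ∃[ l ] l < i × X l ≡ v

  interleaved-top : ∀ {k i j} → Interleaved k i j → X i ≡ k → Interleaved k (suc i) j
  interleaved-top {k} {i} {j} I Xi≡k = record
    { first      = first
    ; nonempty   = z<s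
    ; increasing = <-suc-extend increasing (λ _ _ Xi≢k → ⊥-elim (Xi≢k Xi≡k))
    ; below      = <-suc-extend below (λ Xi≢k → ⊥-elim (Xi≢k Xi≡k))
    ; covers     = λ v<j → let l , l<i , Xl≡v = covers v<j in l , m<n⇒m<1+n l<i , Xl≡v
    }
    where open Interleaved I

  interleaved-new : ∀ {k i j} → Interleaved k i j → j < k → X i ≡ j → Interleaved k (suc i) (suc j)
  interleaved-new {k} {i} {j} I j<k Xi≡j = record
    { first      = first
    ; nonempty   = z<s
    ; increasing = <-suc-extend increasing (λ l<i Xl≢k _ → subst (X _ <_) (sym Xi≡j) (below l<i Xl≢k))
    ; below      = <-suc-extend (λ l<i Xl≢k → m<n⇒m<1+n (below l<i Xl≢k)) (λ _ → s≤s (≤-reflexive Xi≡j))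
    ; covers     = <-suc-extend (λ v<j → let l , l<i , Xl≡v = covers v<j in l , m<n⇒m<1+n l<i , Xl≡v)
                                (i , n<1+n i , Xi≡j)
    }
    where open Interleaved I

  EndsWith : ℕ → ℕ → Set
  EndsWith i v = ∃[ p ] i ≡ suc p × X p ≡ v

  Shape : ℕ → State → Set
  Shape i start            = i ≡ 0
  Shape i zeros            = 0 < i × (∀ {l} → l < i → X l ≡ 0)
  Shape i (interleave j d) = Interleaved (j + suc d) i j
  Shape i (lastNew a)      = Interleaved (suc a) i (suc a) × EndsWith i a
  Shape i (plateau a)      = Interleaved (suc a) i (suc a) × EndsWith i (suc a)
  Shape i (trail a)        = ∃[ q ] suc q < i × Shape (suc q) (plateau a) × (∀ {l} → l < i → q < l → X l ≡ a)

  shape-step : ∀ {i s c s'} → Shape i s → s ⟶[ c ] s' → X i ≡ c → Shape (suc i) s'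
  shape-step refl start→zeros X0≡0 = z<s , λ { z<s → X0≡0 }
  shape-step refl start→interleave X0≡k = record
    { first      = X0≡k
    ; nonempty   = z<s
    ; increasing = λ { z<s () }
    ; below      = λ { z<s X0≢k → ⊥-elim (X0≢k X0≡k) }
    ; covers     = λ ()
    }
  shape-step (0<i , all0) zeros→zeros Xi≡0 = z<s , <-suc-extend all0 Xi≡0
  shape-step I interleave-top Xi≡k = interleaved-top I Xi≡k
  shape-step {i} I (interleave-new {j} {d}) Xi≡j =
    subst (λ k → Interleaved k (suc i) (suc j)) (+-suc j (suc d)) (interleaved-new I (m<m+n j z<s) Xi≡j)
  shape-step {i} I (interleave-last {j}) Xi≡j =
    subst (λ k → Interleaved k (suc i) (suc j)) (+-comm j 1) (interleaved-new I (m<m+n j z<s) Xi≡j) , i , refl , Xi≡j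
  shape-step {i} (I , _) lastNew→plateau Xi≡k = interleaved-top I Xi≡k , i , refl , Xi≡k
  shape-step {i} (I , _) plateau-top Xi≡k = interleaved-top I Xi≡k , i , refl , Xi≡k
  shape-step (I , p , refl , Xp≡k) plateau→trail Xi≡a =
    p , ≤-refl , (I , p , refl , Xp≡k) , <-suc-extend {P = λ l → p < l → X l ≡ _} (λ l<1+p p<l → ⊥-elim (<⇒≱ l<1+p p<l)) (λ _ → Xi≡a)
  shape-step (q , 1+q<i , P , tail) trail-stay Xi≡a =
    q , m<n⇒m<1+n 1+q<i , P , <-suc-extend tail (λ _ → Xi≡a)

  all-zero⇒valid : (∀ {l} → l < n → X l ≡ 0) → RevisedAscentAvoiding231
  all-zero⇒valid all0 = record
    { cayley     = λ i<n v≤Xi → _ , i<n , trans (all0 i<n) (sym (n≤0⇒n≡0 (subst (_ ≤_) (all0 i<n) v≤Xi)))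
    ; ascent⇒nub = λ { _ (inj₁ refl) ()
                     ; {i} _ (inj₂ (1+i<n , asc)) → ⊥-elim (n≮0 (subst (X i <_) (all0 1+i<n) asc)) }
    ; nub⇒ascent = λ { {zero} _ _ → inj₁ refl
                     ; {suc i} 1+i<n nub → ⊥-elim (nub z<s (trans (all0 (<-trans z<s 1+i<n)) (sym (all0 1+i<n)))) }
    ; avoids231  = λ {_} {_} {l} i<j j<l l<n Xl<Xi _ →
                     n≮0 (subst (X l <_) (all0 (<-trans (<-trans i<j j<l) l<n)) Xl<Xi)
    }

  module _ {a q} (q<n : q < n) (I : Interleaved (suc a) (suc q) (suc a)) (Xq≡1+a : X q ≡ suc a)
           (tail : ∀ {l} → l < n → q < l → X l ≡ a) where

    open Interleaved I

    complete-bounded : ∀ {l} → l < n → X l ≤ suc a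
    complete-bounded {l} l<n with l ≤? q | X l ≟ suc a
    ... | yes l≤q | yes Xl≡1+a = ≤-reflexive Xl≡1+a
    ... | yes l≤q | no  Xl≢1+a = <⇒≤ (below (s≤s l≤q) Xl≢1+a)
    ... | no  l≰q | _          = subst (_≤ suc a) (sym (tail l<n (≰⇒> l≰q))) (n≤1+n a)

    complete-cayley : ∀ {v i} → i < n → v ≤ X i → ∃[ j ] j < n × X j ≡ v
    complete-cayley {v} i<n v≤Xi with v ≟ suc a
    ... | yes refl = 0 , ≤-<-trans z≤n i<n , first
    ... | no  v≢1+a =
      let l , l<1+q , Xl≡v = covers (≤∧≢⇒< (≤-trans v≤Xi (complete-bounded i<n)) v≢1+a)
      in  l , <-≤-trans l<1+q q<n , Xl≡v

    complete-ascent⇒nub : ∀ {i} → i < n → Ascent i → Nub i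
    complete-ascent⇒nub _ (inj₁ refl) ()
    complete-ascent⇒nub {i} i<n (inj₂ (1+i<n , asc)) {j} j<i with i ≤? q | X j ≟ suc a
    ... | no  i≰q | _ =
      ⊥-elim (<-irrefl (trans (tail i<n (≰⇒> i≰q)) (sym (tail 1+i<n (m<n⇒m<1+n (≰⇒> i≰q))))) asc)
    ... | yes i≤q | yes Xj≡1+a = λ Xj≡Xi → <⇒≢ Xi<1+a (trans (sym Xj≡Xi) Xj≡1+a)
      where Xi<1+a = <-≤-trans asc (complete-bounded 1+i<n)
    ... | yes i≤q | no  Xj≢1+a = <⇒≢ (increasing (s≤s i≤q) j<i Xj≢1+a (<⇒≢ Xi<1+a))
      where Xi<1+a = <-≤-trans asc (complete-bounded 1+i<n)

    complete-nub⇒ascent : ∀ {i} → i < n → Nub i → Ascent i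
    complete-nub⇒ascent {zero}  _     _   = inj₁ refl
    complete-nub⇒ascent {suc i} 1+i<n nub = inj₂ (<-≤-trans (s≤s 1+i<q) q<n , asc)
      where
      X1+i≢1+a : X (suc i) ≢ suc a
      X1+i≢1+a X1+i≡1+a = nub z<s (trans first (sym X1+i≡1+a))
      1+i≤q : suc i ≤ q
      1+i≤q with suc i ≤? q
      ... | yes 1+i≤q = 1+i≤q
      ... | no  1+i≰q =
        let l , l<1+q , Xl≡a = covers (n<1+n a)
        in  ⊥-elim (nub (<-≤-trans l<1+q (≰⇒> 1+i≰q)) (trans Xl≡a (sym (tail 1+i<n (≰⇒> 1+i≰q)))))
      1+i<q : suc i < q
      1+i<q = ≤∧≢⇒< 1+i≤q (λ 1+i≡q → X1+i≢1+a (trans (cong X 1+i≡q) Xq≡1+a))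
      asc : X (suc i) < X (suc (suc i))
      asc with X (suc (suc i)) ≟ suc a
      ... | yes X2+i≡1+a = subst (X (suc i) <_) (sym X2+i≡1+a) (below (s≤s 1+i≤q) X1+i≢1+a)
      ... | no  X2+i≢1+a = increasing (s≤s 1+i<q) (n<1+n (suc i)) X1+i≢1+a X2+i≢1+a

    complete-avoids231 : ∀ {i j l} → i < j → j < l → l < n → X l < X i → X i < X j → ⊥
    complete-avoids231 {i} {j} {l} i<j j<l l<n Xl<Xi Xi<Xj with l ≤? q
    ... | yes l≤q = <-asym Xl<Xi (increasing (s≤s l≤q) (<-trans i<j j<l) (<⇒≢ Xi<1+a) (<⇒≢ (<-trans Xl<Xi Xi<1+a)))
      where Xi<1+a = <-≤-trans Xi<Xj (complete-bounded (<-trans j<l l<n))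
    ... | no  l≰q = <⇒≱ (<-≤-trans Xi<Xj (complete-bounded (<-trans j<l l<n)))
                        (subst (_< X i) (tail l<n (≰⇒> l≰q)) Xl<Xi)

    complete⇒valid : RevisedAscentAvoiding231
    complete⇒valid = record
      { cayley     = complete-cayley
      ; ascent⇒nub = complete-ascent⇒nub
      ; nub⇒ascent = complete-nub⇒ascent
      ; avoids231  = complete-avoids231
      }

  shape⇒valid : ∀ {s} → Shape n s → T (final s) → RevisedAscentAvoiding231
  shape⇒valid {zeros}     (_ , all0) _ = all-zero⇒valid all0
  shape⇒valid {plateau a} (I , q , refl , Xq≡1+a) _ =
    complete⇒valid ≤-refl I Xq≡1+a (λ l<1+q q<l → ⊥-elim (<⇒≱ l<1+q q<l))
  shape⇒valid {trail a}   (q , 1+q<n , (I , _ , refl , Xq≡1+a) , tail) _ =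
    complete⇒valid (<-trans (n<1+n q) 1+q<n) I Xq≡1+a tail

  interleaved-fresh-nub : ∀ {k i j} → Interleaved k i j → X i ≢ k → j ≤ X i → Nub i
  interleaved-fresh-nub I Xi≢k j≤Xi {l} l<i Xl≡Xi with X l ≟ _
  ... | yes Xl≡k = Xi≢k (trans (sym Xl≡Xi) Xl≡k)
  ... | no  Xl≢k = <⇒≱ (Interleaved.below I l<i Xl≢k) (subst (_ ≤_) (sym Xl≡Xi) j≤Xi)

  interleaved-last-nub : ∀ {k p j} → Interleaved k (suc p) j → X p ≢ k → Nub p
  interleaved-last-nub {p = p} I Xp≢k {l} l<p Xl≡Xp with X l ≟ _
  ... | yes Xl≡k = Xp≢k (trans (sym Xl≡Xp) Xl≡k)
  ... | no  Xl≢k = <⇒≢ (Interleaved.increasing I (n<1+n p) l<p Xl≢k Xp≢k) Xl≡Xp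

  module _ (nub⇒ascent : ∀ {i} → i < n → Nub i → Ascent i) where

    nub⇒rise : ∀ {i} → 0 < i → i < n → Nub i → suc i < n × X i < X (suc i)
    nub⇒rise 0<i i<n nub with nub⇒ascent i<n nub
    ... | inj₁ refl = ⊥-elim (<-irrefl refl 0<i)
    ... | inj₂ rise = rise

    first-is-max : ∀ {i} → i < n → X i ≤ X 0
    first-is-max {i} i<n with maximum-position (≤-<-trans z≤n i<n)
    ... | t , t<n , max with first-occurrence t
    ...   | zero  , _   , X0≡Xt , _   = subst (X i ≤_) (sym X0≡Xt) (max i<n)
    ...   | suc p , p≤t , Xp≡Xt , nub =
      ⊥-elim (<⇒≱ asc (subst (X (suc (suc p)) ≤_) (sym Xp≡Xt) (max 2+p<n)))
      where
      rise = nub⇒rise z<s (≤-<-trans p≤t t<n) nub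
      2+p<n = proj₁ rise
      asc = proj₂ rise

  IsSuffixAt : ∀ {L} → Vec (Fin n) L → ℕ → Set
  IsSuffixAt w i = ∀ l → entry w l ≡ X (l + i)

  suffix-tail : ∀ {L v i} {w : Vec (Fin n) L} → IsSuffixAt (v ∷ w) i → IsSuffixAt w (suc i)
  suffix-tail {i = i} v∷w≡X l = trans (v∷w≡X (suc l)) (cong X (sym (+-suc l i)))

  open Counting n using (accepts)

  accepted⇒valid : ∀ {L} (w : Vec (Fin n) L) {i s} → L + i ≡ n → IsSuffixAt w i →
                   Shape i s → T (accepts s w) → RevisedAscentAvoiding231
  accepted⇒valid []      refl _ S acc = shape⇒valid S acc
  accepted⇒valid {suc L} (v ∷ w) {i} {s} 1+L+i≡n v∷w≡X S acc with step s (toℕ v) in eq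
  ... | nothing = ⊥-elim acc
  ... | just s' = accepted⇒valid w (trans (+-suc L i) 1+L+i≡n) (suffix-tail v∷w≡X)
                    (shape-step S (step-sound eq) (sym (v∷w≡X 0))) acc

  module _ (V : RevisedAscentAvoiding231) where

    open RevisedAscentAvoiding231 V

    below-first : ∀ {k i j l} → Interleaved k i j → l < n → X l ≤ k
    below-first {l = l} I l<n = subst (X l ≤_) (Interleaved.first I) (first-is-max nub⇒ascent l<n)

    pending-position : ∀ {k i j} → 0 < n → Interleaved k i j → j < k → ∃[ t ] t < n × i ≤ t × X t ≡ j
    pending-position {k} {i} {j} 0<n I j<k with cayley 0<n (subst (j ≤_) (sym (Interleaved.first I)) (<⇒≤ j<k))
    ... | t , t<n , Xt≡j with t <? i
    ...   | yes t<i = ⊥-elim (<⇒≢ (Interleaved.below I t<i (λ Xt≡k → <⇒≢ j<k (trans (sym Xt≡j) Xt≡k))) Xt≡j)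
    ...   | no  t≮i = t , t<n , ≮⇒≥ t≮i , Xt≡j

    no-small-letter : ∀ {k i j t} → Interleaved k i j → i < t → t < n → X t ≡ j → X i < j → ⊥
    no-small-letter I i<t t<n Xt≡j Xi<j
      with ascent-between i<t (subst (_ <_) (sym Xt≡j) Xi<j)
    ... | l , i≤l , l<t , Xl≤Xi , asc with Interleaved.covers I (≤-<-trans Xl≤Xi Xi<j)
    ...   | l' , l'<i , Xl'≡Xl =
      ascent⇒nub (<-trans l<t t<n) (inj₂ (≤-<-trans l<t t<n , asc)) (<-≤-trans l'<i i≤l) Xl'≡Xl

    no-large-letter : ∀ {k i j t} → Interleaved k i j → i < t → t < n → X t ≡ j → X i ≢ k → j < X i → ⊥
    no-large-letter {i = i} I i<t t<n Xt≡j Xi≢k j<Xi =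
      [ (λ 1+i<t → avoids231 (n<1+n i) 1+i<t t<n Xt<Xi rise) , (λ { refl → <-asym rise Xt<Xi }) ]′
        (m≤n⇒m<n∨m≡n i<t)
      where
      Xt<Xi = subst (_< X i) (sym Xt≡j) j<Xi
      rise  = proj₂ (nub⇒rise nub⇒ascent (Interleaved.nonempty I) (<-trans i<t t<n)
                      (interleaved-fresh-nub I Xi≢k (<⇒≤ j<Xi)))

    interleave-next : ∀ {i j d} → i < n → Shape i (interleave j d) → X i ≡ j + suc d ⊎ X i ≡ j
    interleave-next {i} {j} {d} i<n I with X i ≟ j + suc d | X i ≟ j
    ... | yes Xi≡k | _        = inj₁ Xi≡k
    ... | no  _    | yes Xi≡j = inj₂ Xi≡j
    ... | no  Xi≢k | no  Xi≢j with pending-position (≤-<-trans z≤n i<n) I (m<m+n j z<s)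
    ...   | t , t<n , i≤t , Xt≡j with m≤n⇒m<n∨m≡n i≤t
    ...     | inj₂ refl = ⊥-elim (Xi≢j Xt≡j)
    ...     | inj₁ i<t with <-cmp (X i) j
    ...       | tri< Xi<j _    _    = ⊥-elim (no-small-letter I i<t t<n Xt≡j Xi<j)
    ...       | tri≈ _    Xi≡j _    = ⊥-elim (Xi≢j Xi≡j)
    ...       | tri> _    _    j<Xi = ⊥-elim (no-large-letter I i<t t<n Xt≡j Xi≢k j<Xi)

    lastNew-next : ∀ {i a} → i < n → Shape i (lastNew a) → X i ≡ suc a
    lastNew-next {a = a} i<n (I , p , refl , Xp≡a) = ≤-antisym (below-first I i<n) (subst (_< _) Xp≡a a<Xi)
      where
      Xp≢1+a : X p ≢ suc a
      Xp≢1+a Xp≡1+a = 1+n≢n (trans (sym Xp≡1+a) Xp≡a)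
      0<p : 0 < p
      0<p = n≢0⇒n>0 λ { refl → Xp≢1+a (Interleaved.first I) }
      a<Xi = proj₂ (nub⇒rise nub⇒ascent 0<p (<-trans (n<1+n p) i<n) (interleaved-last-nub I Xp≢1+a))

    plateau-next : ∀ {i a} → i < n → Shape i (plateau a) → X i ≡ suc a ⊎ X i ≡ a
    plateau-next {i} {a} i<n (I , p , refl , Xp≡1+a) with X i ≟ suc a
    ... | yes Xi≡1+a = inj₁ Xi≡1+a
    ... | no  Xi≢1+a = inj₂ (≤-antisym (s≤s⁻¹ (≤∧≢⇒< (below-first I i<n) Xi≢1+a)) (≮⇒≥ no-drop))
      where
      no-drop : ¬ X i < a
      no-drop Xi<a with Interleaved.covers I (n<1+n a)
      ... | l , l<1+p , Xl≡a = avoids231 l<p (n<1+n p) i<n (subst (X i <_) (sym Xl≡a) Xi<a)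
                                 (subst₂ _<_ (sym Xl≡a) (sym Xp≡1+a) (n<1+n a))
        where l<p = ≤∧≢⇒< (s≤s⁻¹ l<1+p) λ { refl → 1+n≢n (trans (sym Xp≡1+a) Xl≡a) }

    trail-next : ∀ {i a} → i < n → Shape i (trail a) → X i ≡ a
    trail-next {suc r} {a} 1+r<n (q , 1+q<1+r , (I , _ , refl , Xq≡1+a) , tail) =
      ≤-antisym (s≤s⁻¹ (≤∧≢⇒< (below-first I 1+r<n) no-rise)) (≮⇒≥ no-drop)
      where
      q<r = s≤s⁻¹ 1+q<1+r
      Xr≡a = tail (n<1+n r) q<r
      earlier-a : ∃[ l ] l < q × X l ≡ a
      earlier-a with Interleaved.covers I (n<1+n a)
      ... | l , l<1+q , Xl≡a =
        l , ≤∧≢⇒< (s≤s⁻¹ l<1+q) (λ { refl → 1+n≢n (trans (sym Xq≡1+a) Xl≡a) }) , Xl≡a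
      no-rise : X (suc r) ≢ suc a
      no-rise X1+r≡1+a with earlier-a
      ... | l , l<q , Xl≡a = ascent⇒nub (<-trans (n<1+n r) 1+r<n)
                               (inj₂ (1+r<n , subst₂ _<_ (sym Xr≡a) (sym X1+r≡1+a) (n<1+n a)))
                               (<-trans l<q q<r) (trans Xl≡a (sym Xr≡a))
      no-drop : ¬ X (suc r) < a
      no-drop X1+r<a with earlier-a
      ... | l , l<q , Xl≡a = avoids231 l<q (<-trans q<r (n<1+n r)) 1+r<n (subst (X (suc r) <_) (sym Xl≡a) X1+r<a)
                               (subst₂ _<_ (sym Xl≡a) (sym Xq≡1+a) (n<1+n a))

    reads : ∀ {i s c s'} → X i ≡ c → s ⟶[ c ] s' → ∃[ s' ] s ⟶[ X i ] s'
    reads refl s⟶s' = _ , s⟶s'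

    valid-step : ∀ {i s} → i < n → Shape i s → ∃[ s' ] s ⟶[ X i ] s'
    valid-step {i} {start}          _   _            = start-step (X i)
    valid-step {i} {zeros}          i<n (0<i , all0) =
      reads (n≤0⇒n≡0 (subst (X i ≤_) (all0 0<i) (first-is-max nub⇒ascent i<n))) zeros→zeros
    valid-step {i} {interleave j d} i<n S =
      [ (λ Xi≡k → reads Xi≡k interleave-top) , (λ Xi≡j → reads Xi≡j (interleave⟶afterNew j d)) ]′
        (interleave-next i<n S)
    valid-step {i} {lastNew a}      i<n S = reads (lastNew-next i<n S) lastNew→plateau
    valid-step {i} {plateau a}      i<n S =
      [ (λ Xi≡1+a → reads Xi≡1+a plateau-top) , (λ Xi≡a → reads Xi≡a plateau→trail) ]′ (plateau-next i<n S)
    valid-step {i} {trail a}        i<n S = reads (trail-next i<n S) trail-stay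

    valid-final : ∀ {s} → 0 < n → Shape n s → T (final s)
    valid-final {start}          0<n n≡0 = <-irrefl (sym n≡0) 0<n
    valid-final {zeros}          _   _   = _
    valid-final {interleave j d} 0<n I with pending-position 0<n I (m<m+n j z<s)
    ... | t , t<n , n≤t , _ = <⇒≱ t<n n≤t
    valid-final {lastNew a}      _   (I , p , refl , Xp≡a) = <-irrefl refl (proj₁ rise)
      where
      Xp≢1+a : X p ≢ suc a
      Xp≢1+a Xp≡1+a = 1+n≢n (trans (sym Xp≡1+a) Xp≡a)
      0<p = n≢0⇒n>0 λ { refl → Xp≢1+a (Interleaved.first I) }
      rise = nub⇒rise nub⇒ascent 0<p (n<1+n p) (interleaved-last-nub I Xp≢1+a)
    valid-final {plateau _}      _   _   = _
    valid-final {trail _}        _   _   = _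

    valid⇒accepted : 0 < n → ∀ {L} (w : Vec (Fin n) L) {i s} → L + i ≡ n → IsSuffixAt w i →
                     Shape i s → T (accepts s w)
    valid⇒accepted 0<n []      refl _ S = valid-final 0<n S
    valid⇒accepted 0<n {suc L} (v ∷ w) {i} {s} 1+L+i≡n v∷w≡X S
      with valid-step (subst (i <_) 1+L+i≡n (s≤s (m≤n+m i L))) S
    ... | s' , s⟶s' rewrite step-complete (subst (s ⟶[_] s') (sym (v∷w≡X 0)) s⟶s') =
      valid⇒accepted 0<n w (trans (+-suc L i) 1+L+i≡n) (suffix-tail v∷w≡X) (shape-step S s⟶s' refl)

module Translation {n} (x : Endo n) where

  open Word n (entry x)

  val≡entry : ∀ i → val x i ≡ entry x (toℕ i)
  val≡entry = lookup-entry x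

  toFin : ∀ {j} → j < n → ∃[ f ] toℕ f ≡ j
  toFin j<n = fromℕ< j<n , toℕ-fromℕ< j<n

  ascbot⇒ascent : ∀ i → InAscbot x i → Ascent (toℕ i)
  ascbot⇒ascent i (inj₁ i≡0)           = inj₁ i≡0
  ascbot⇒ascent i (inj₂ (j , j≡1+i , lt)) =
    inj₂ (subst (_< n) j≡1+i (toℕ<n j) , subst₂ _<_ (val≡entry i) (trans (val≡entry j) (cong (entry x) j≡1+i)) lt)

  ascent⇒ascbot : ∀ i → Ascent (toℕ i) → InAscbot x i
  ascent⇒ascbot i (inj₁ i≡0)           = inj₁ i≡0
  ascent⇒ascbot i (inj₂ (1+i<n , lt)) with toFin 1+i<n
  ... | j , j≡1+i =
    inj₂ (j , j≡1+i , subst₂ _<_ (sym (val≡entry i)) (sym (trans (val≡entry j) (cong (entry x) j≡1+i))) lt)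

  inNub⇒nub : ∀ i → InNub x i → Nub (toℕ i)
  inNub⇒nub i nub j<i with toFin (<-trans j<i (toℕ<n i))
  ... | j , refl = λ Xj≡Xi → nub j j<i (trans (val≡entry j) (trans Xj≡Xi (sym (val≡entry i))))

  nub⇒inNub : ∀ i → Nub (toℕ i) → InNub x i
  nub⇒inNub i nub j j<i vj≡vi = nub j<i (trans (sym (val≡entry j)) (trans vj≡vi (val≡entry i)))

  defs⇒valid : IsRevisedAscent x → Avoids231 x → RevisedAscentAvoiding231
  defs⇒valid (cay , asc⇔nub) av = record
    { cayley     = cayley
    ; ascent⇒nub = ascent⇒nub
    ; nub⇒ascent = nub⇒ascent
    ; avoids231  = avoids231
    }
    where
    cayley : ∀ {v i} → i < n → v ≤ entry x i → ∃[ j ] j < n × entry x j ≡ v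
    cayley i<n v≤Xi with toFin i<n
    ... | i , refl with toFin (≤-<-trans v≤Xi (subst (_< n) (val≡entry i) (toℕ<n (lookup x i))))
    ...   | v , refl with cay v i (subst (_ ≤_) (sym (val≡entry i)) v≤Xi)
    ...     | j , xj≡v = toℕ j , toℕ<n j , trans (sym (val≡entry j)) (cong toℕ xj≡v)
    ascent⇒nub : ∀ {i} → i < n → Ascent i → Nub i
    ascent⇒nub i<n with toFin i<n
    ... | i , refl = inNub⇒nub i ∘ proj₁ (asc⇔nub i) ∘ ascent⇒ascbot i
    nub⇒ascent : ∀ {i} → i < n → Nub i → Ascent i
    nub⇒ascent i<n with toFin i<n
    ... | i , refl = ascbot⇒ascent i ∘ proj₂ (asc⇔nub i) ∘ nub⇒inNub i
    avoids231 : ∀ {i j l} → i < j → j < l → l < n → entry x l < entry x i → entry x i < entry x j → ⊥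
    avoids231 i<j j<l l<n with toFin l<n | toFin (<-trans j<l l<n) | toFin (<-trans i<j (<-trans j<l l<n))
    ... | l , refl | j , refl | i , refl = λ Xl<Xi Xi<Xj →
      av (i , j , l , i<j , j<l , subst₂ _<_ (sym (val≡entry l)) (sym (val≡entry i)) Xl<Xi
                                , subst₂ _<_ (sym (val≡entry i)) (sym (val≡entry j)) Xi<Xj)

  valid⇒defs : RevisedAscentAvoiding231 → IsRevisedAscent x × Avoids231 x
  valid⇒defs V = (cay , λ i → (nub⇒inNub i ∘ ascent⇒nub (toℕ<n i) ∘ ascbot⇒ascent i)
                            , (ascent⇒ascbot i ∘ nub⇒ascent (toℕ<n i) ∘ inNub⇒nub i)) , av
    where
    open RevisedAscentAvoiding231 V
    cay : IsCayley x
    cay v i v≤xi with cayley (toℕ<n i) (subst (toℕ v ≤_) (val≡entry i) v≤xi)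
    ... | j , j<n , Xj≡v with toFin j<n
    ...   | j , refl = j , toℕ-injective (trans (val≡entry j) Xj≡v)
    av : Avoids231 x
    av (i , j , l , i<j , j<l , xl<xi , xi<xj) =
      avoids231 i<j j<l (toℕ<n l) (subst₂ _<_ (val≡entry l) (val≡entry i) xl<xi)
                                  (subst₂ _<_ (val≡entry i) (val≡entry j) xi<xj)

  open Counting n using (accepts)

  whole-word : IsSuffixAt x 0
  whole-word l = cong (entry x) (sym (+-identityʳ l))

  defs⇒accepted : 0 < n → IsRevisedAscent x × Avoids231 x → T (accepts start x)
  defs⇒accepted 0<n (ras , av) = valid⇒accepted (defs⇒valid ras av) 0<n x (+-identityʳ n) whole-word refl

  accepted⇒defs : T (accepts start x) → IsRevisedAscent x × Avoids231 x
  accepted⇒defs acc = valid⇒defs (accepted⇒valid x (+-identityʳ n) whole-word refl acc)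

mainTheorem6 : (m : ℕ) → length (B̂231 (suc m)) ≡ (2 ^ m ∸ suc m) + 1
mainTheorem6 m = begin
  length (B̂231 (suc m))
    ≡⟨ cong length (filter-≐ (λ x → isRevisedAscent? x ×-dec avoids231? x) (T? ∘ accepts start)
                             ((λ {x} → defs⇒accepted x z<s) , (λ {x} → accepted⇒defs x)) (allVecs (suc m))) ⟩
  #accepted start (suc m)                        ≡⟨ #accepted-start m ⟩
  1 + sum (applyUpTo (λ d → m C suc (suc d)) m)  ≡⟨ binomial-tail-sum m ⟩
  (2 ^ m ∸ suc m) + 1                            ∎
  where
  open ≡-Reasoning
  open Counting (suc m) using (accepts; #accepted)
  open Translation using (defs⇒accepted; accepted⇒defs)
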